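{- Let $\mathbb{F}_q$ be a finite field of characteristic $p>2$, and work with $\mathbb N\times\mathbb N$ matrices over $\mathbb{F}_q$. For every $k\in\mathbb N$, $$\big(\oplus(\mathcal{I})-\ominus(\mathcal{I})\big)^{p^k}=\oplus^{p^k}(\mathcal{I})-\ominus^{p^k}(\mathcal{I})-\mathcal{J}^{(a)}_{p^k-1}.$$ Furthermore, for even $l\in\{1,\ldots,p-1\}$, $$\big(\oplus(\mathcal{I})-\ominus(\mathcal{I})\big)^{p^kl}=\sum_{i=0}^{l}\binom{l}{i}(-1)^i\oplus^{p^k(l-2i)}(\mathcal{I})+\sum_{i=0}^{l/2-1}\binom{l}{i}(-1)^i\mathcal{J}^{(a)}_{p^k(l-2i)-1},$$ and for odd $l\in\{1,\ldots,p-1\}$, $$\big(\oplus(\mathcal{I})-\ominus(\mathcal{I})\big)^{p^kl}=\sum_{i=0}^{l}\binom{l}{i}(-1)^i\oplus^{p^k(l-2i)}(\mathcal{I})-\sum_{i=0}^{(l-1)/2}\binom{l}{i}(-1)^i\mathcal{J}^{(a)}_{p^k(l-2i)-1}.$$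
   Context: $\mathcal{I}$ is the $\mathbb N\times\mathbb N$ identity matrix (indices start at 1). For $\mathcal{M}=(m_{i,j})_{i,j\ge1}$, $\oplus(\mathcal{M})$ has $(i,j)$ entry $m_{i-1,j}$ if $i>1$ and $0$ if $i=1$, and $\ominus(\mathcal{M})$ has $(i,j)$ entry $m_{i+1,j}$. For $s\ge0$, $\oplus^s,\ominus^s$ denote $s$-fold iterates ($\oplus^0$ is the identity map), and $\oplus^{ -s}:=\ominus^{s}$. $\mathcal{J}^{(a)}_l$ is the matrix whose $(i,j)$ entry is $(-1)^{i-1}$ if $i+j=l+1$ and $0$ otherwise. Integer coefficients are interpreted in $\mathbb{F}_q$. -}

module Defs where

open import Level using (Level; _⊔_)
open import Algebra.Bundles using (CommutativeRing)
open import Data.Nat as ℕ using (ℕ; zero; suc; _≤_; _<_; _≟_; z≤n; s≤s)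
open import Data.Nat.Properties using (≤-trans; n≤1+n)
open import Data.Nat.Primality using (Prime)
open import Data.Integer as ℤ using (ℤ; +_; -[1+_])
open import Data.Fin using (Fin)
open import Data.Product using (Σ; ∃; _×_; _,_)
open import Relation.Nullary using (¬_; yes; no)
open import Relation.Binary.PropositionalEquality as P using (_≡_)

module FieldDefs {c ℓ : Level} (R : CommutativeRing c ℓ) where
  open CommutativeRing R hiding (zero)

  fromℕ : ℕ → Carrier
  fromℕ zero    = 0#
  fromℕ (suc n) = 1# + fromℕ n

  record IsField : Set (c ⊔ ℓ) where
    field
      1≉0 : ¬ (1# ≈ 0#)
      inverse : ∀ x → ¬ (x ≈ 0#) → Σ Carrier (λ y → x * y ≈ 1#)

  IsFinite : Set (c ⊔ ℓ)
  IsFinite = Σ ℕ (λ n → Σ (Fin n → Carrier) (λ f → ∀ x → Σ (Fin n) (λ i → f i ≈ x)))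

  -- characteristic p, for p prime: p·1 = 0 (in a field this forces char = p)
  HasCharacteristic : ℕ → Set ℓ
  HasCharacteristic p = fromℕ p ≈ 0#

-- ℕ × ℕ matrices over the ring.
-- CONVENTION: Agda index i : ℕ corresponds to the paper's index i+1
-- (Agda row/column 0 = paper row/column 1).
module MatrixDefs {c ℓ : Level} (R : CommutativeRing c ℓ) where
  open CommutativeRing R hiding (zero)
  open FieldDefs R public using (fromℕ)

  Matrix : Set c
  Matrix = ℕ → ℕ → Carrier

  _≋_ : Matrix → Matrix → Set ℓ
  M ≋ N = ∀ i j → M i j ≈ N i j
  infix 4 _≋_

  _⊞_ : Matrix → Matrix → Matrix
  (M ⊞ N) i j = M i j + N i j

  _⊟_ : Matrix → Matrix → Matrix
  (M ⊟ N) i j = M i j - N i j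

  _⊙_ : Carrier → Matrix → Matrix
  (a ⊙ M) i j = a * M i j

  𝟘 : Matrix
  𝟘 i j = 0#

  𝕀 : Matrix
  𝕀 i j with i ≟ j
  ... | yes _ = 1#
  ... | no  _ = 0#

  ⊕ : Matrix → Matrix
  ⊕ M zero    j = 0#
  ⊕ M (suc i) j = M i j

  ⊖ : Matrix → Matrix
  ⊖ M i j = M (suc i) j

  iter : ℕ → (Matrix → Matrix) → Matrix → Matrix
  iter zero    f M = M
  iter (suc n) f M = f (iter n f M)

  ⊕^ : ℤ → Matrix → Matrix
  ⊕^ (+ n)     M = iter n ⊕ M
  ⊕^ -[1+ n ]  M = iter (suc n) ⊖ M

  ⊖^ : ℕ → Matrix → Matrix
  ⊖^ n M = iter n ⊖ M

  sgn : ℕ → Carrier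
  sgn zero    = 1#
  sgn (suc n) = - (sgn n)

  -- J^{(a)}_l : (i,j) entry (-1)^{i-1} if i+j = l+1 (paper, 1-based), else 0.
  -- In 0-based Agda indices: (-1)^i if i + j + 1 = l.
  J : ℕ → Matrix
  J l i j with suc (i ℕ.+ j) ≟ l
  ... | yes _ = sgn i
  ... | no  _ = 0#

  Σ< : ℕ → (ℕ → Carrier) → Carrier
  Σ< zero    f = 0#
  Σ< (suc n) f = Σ< n f + f n

  -- finite sum of matrices Σ_{i=0}^{n} f i   (inclusive upper bound)
  Σ≤ : ℕ → (ℕ → Matrix) → Matrix
  Σ≤ zero    f = f zero
  Σ≤ (suc n) f = Σ≤ n f ⊞ f (suc n)

  -- Row-finite matrices: row i vanishes from column (bound i) on.
  -- The product of a row-finite matrix with an arbitrary matrix is the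
  -- usual (here finite) sum  (MN)_{ij} = Σ_k m_{ik} n_{kj}.
  record RowFinite : Set (c ⊔ ℓ) where
    field
      entry      : Matrix
      bound      : ℕ → ℕ
      zeroBeyond : ∀ i j → bound i ≤ j → entry i j ≈ 0#
  open RowFinite public

  _·_ : RowFinite → Matrix → Matrix
  (M · N) i j = Σ< (bound M i) (λ k → entry M i k * N k j)

  _^^_ : RowFinite → ℕ → Matrix
  M ^^ zero  = 𝕀
  M ^^ suc n = M · (M ^^ n)

  A : Matrix
  A = ⊕ 𝕀 ⊟ ⊖ 𝕀

  private
    𝕀-off : ∀ a b → suc a ≤ b → 𝕀 a b ≈ 0#
    𝕀-off a b a<b with a ≟ b
    ... | no _ = refl
    𝕀-off a .a a<a | yes P.refl = ⊥-elim′ a<a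
      where
        ⊥-elim′ : ∀ {n} → suc n ≤ n → 1# ≈ 0#
        ⊥-elim′ (s≤s p) = ⊥-elim′ p

    open import Relation.Binary.Reasoning.Setoid setoid

    A-zero : ∀ i j → suc (suc i) ≤ j → A i j ≈ 0#
    A-zero zero j p = begin
        0# - 𝕀 1 j ≈⟨ +-congˡ (-‿cong (𝕀-off 1 j p)) ⟩
        0# - 0#    ≈⟨ -‿inverseʳ 0# ⟩
        0# ∎
    A-zero (suc i) j p = begin
        𝕀 i j - 𝕀 (suc (suc i)) j ≈⟨ +-cong (𝕀-off i j (≤-trans (n≤1+n _) (≤-trans (n≤1+n _) p))) (-‿cong (𝕀-off (suc (suc i)) j p)) ⟩
        0# - 0#    ≈⟨ -‿inverseʳ 0# ⟩
        0# ∎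

  A-rf : RowFinite
  A-rf = record { entry = A ; bound = λ i → suc (suc i) ; zeroBeyond = A-zero }

{-# OPTIONS --safe #-}
-- Think of ⊕(I) − ⊖(I) as the operator Δ f (z) = f (z − 1) − f (z + 1) on functions ℤ → F_q,
-- with the boundary row handled by the method of images: the (a, b) entry of its N-th power is
-- K (a − b) + (−1)^b K (a + b + 2) for K = Δ^N δ, because Δ^N δ (−d) = (−1)^d Δ^N δ (d).
-- Writing Δ_s f (z) = f (z − s) − f (z + s), the binomial expansion of Δ_s^p has vanishing inner
-- coefficients in characteristic p, so Δ_s^p = Δ_{sp} and hence Δ^(p^k l) = Δ_{p^k}^l, whose
-- expansion is Σ_i C(l,i) (−1)^i δ (· − p^k (l − 2i)). The direct terms are the shifts
-- ⊕^{p^k (l − 2i)}(I); the mirror terms with 2i < l are the matrices J_{p^k (l − 2i) − 1},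
-- with the overall sign (−1)^l since p^k is odd.
module Submission where

open import Defs
open import Level using (Level)
open import Algebra.Bundles using (CommutativeRing)
open import Data.Nat as ℕ using (ℕ; zero; suc; _!)
import Data.Nat.Properties as ℕP
open import Data.Nat.Divisibility using (_∣_; divides; ∣⇒≤; ∣1⇒≡1; _∣0; ∣-refl; ∣m∣n⇒∣m+n)
open import Data.Nat.Primality using (Prime; euclidsLemma; composite; ¬prime[1])
open import Data.Nat.Combinatorics using (_C_; k![n∸k]!∣n!; nCk+nC[k+1]≡[n+1]C[k+1]; nCn≡1)
open import Data.Nat.Combinatorics.Specification using (nCk≡n!/k![n-k]!; k>n⇒nCk≡0)
open import Data.Nat.DivMod using (m/n*n≡m)
open import Data.Integer as ℤ using (ℤ; +_; -[1+_])
import Data.Integer.Properties as ℤP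
open import Data.Integer.Tactic.RingSolver using (solve-∀)
open import Data.Sum using (inj₁; inj₂)
open import Data.Empty using (⊥-elim)
open import Relation.Nullary using (¬_; yes; no; contradiction)
open import Relation.Binary.PropositionalEquality as ≡ using (_≡_; _≢_)

p∤m! : ∀ {p m} → Prime p → m ℕ.< p → ¬ p ∣ m !
p∤m! {m = zero}  p-prime _   p∣1 = ¬prime[1] (≡.subst Prime (∣1⇒≡1 p∣1) p-prime)
p∤m! {m = suc m} p-prime m<p p∣[1+m]! with euclidsLemma (suc m) (m !) p-prime p∣[1+m]!
... | inj₁ p∣1+m = ℕP.<⇒≱ m<p (∣⇒≤ p∣1+m)
... | inj₂ p∣m!  = p∤m! p-prime (ℕP.<-trans (ℕP.n<1+n m) m<p) p∣m!

-- p! = (p C k) · k! · (p ∸ k)!, and p divides the left side but neither factorial.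
p∣pCk : ∀ {p k} → Prime p → 0 ℕ.< k → k ℕ.< p → p ∣ p C k
p∣pCk {zero}          _       _   ()
p∣pCk {p@(suc p-1)} {k} p-prime 0<k k<p
  with euclidsLemma (p C k) (k ! ℕ.* (p ℕ.∸ k) !) p-prime p∣pCk*k![p∸k]!
  where
  instance
    k![p∸k]!≢0 : ℕ.NonZero (k ! ℕ.* (p ℕ.∸ k) !)
    k![p∸k]!≢0 = k ℕP.!* (p ℕ.∸ k) !≢0
  k≤p = ℕP.<⇒≤ k<p
  p!≡pCk*k![p∸k]! : p ! ≡ (p C k) ℕ.* (k ! ℕ.* (p ℕ.∸ k) !)
  p!≡pCk*k![p∸k]! = ≡.trans (≡.sym (m/n*n≡m (k![n∸k]!∣n! k≤p)))
                            (≡.cong (ℕ._* (k ! ℕ.* (p ℕ.∸ k) !)) (≡.sym (nCk≡n!/k![n-k]! k≤p)))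
  p∣pCk*k![p∸k]! : p ∣ (p C k) ℕ.* (k ! ℕ.* (p ℕ.∸ k) !)
  p∣pCk*k![p∸k]! = divides (p-1 !) (≡.trans (≡.sym p!≡pCk*k![p∸k]!) (ℕP.*-comm p (p-1 !)))
... | inj₁ p∣pCk = p∣pCk
... | inj₂ p∣k![p∸k]! with euclidsLemma (k !) ((p ℕ.∸ k) !) p-prime p∣k![p∸k]!
...   | inj₁ p∣k!      = contradiction p∣k! (p∤m! p-prime k<p)
...   | inj₂ p∣[p∸k]!  = contradiction p∣[p∸k]! (p∤m! p-prime (ℕP.∸-monoʳ-< 0<k (ℕP.<⇒≤ k<p)))

prime>2⇒¬2∣ : ∀ {p} → Prime p → 2 ℕ.< p → ¬ 2 ∣ p
prime>2⇒¬2∣ p-prime 2<p 2∣p = Prime.notComposite p-prime (composite 2<p 2∣p)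

module ShiftDifferencePowers {c ℓ : Level} (R : CommutativeRing c ℓ) where
  open CommutativeRing R hiding (zero)
  open MatrixDefs R
  open import Algebra.Properties.Ring ring
    using (-1*x≈-x; -‿distribˡ-*; -‿distribʳ-*; x[y-z]≈xy-xz; [y-z]x≈yx-zx)
  open import Algebra.Properties.AbelianGroup +-abelianGroup
    using (⁻¹-involutive; ⁻¹-∙-comm; ⁻¹-anti-homo‿-)
  open import Algebra.Properties.CommutativeSemigroup +-commutativeSemigroup using (interchange)
  open import Algebra.Properties.CommutativeSemigroup *-commutativeSemigroup using (x∙yz≈y∙xz)
  open import Algebra.Properties.Semiring.Mult semiring using (×-homo-+; ×1-homo-*)
    renaming (_×_ to _×ʳ_)
  open import Relation.Binary.Reasoning.Setoid setoid

  fromℕ≡×1 : ∀ n → fromℕ n ≡ n ×ʳ 1#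
  fromℕ≡×1 zero    = ≡.refl
  fromℕ≡×1 (suc n) = ≡.cong (λ x → 1# + x) (fromℕ≡×1 n)

  fromℕ-+ : ∀ m n → fromℕ (m ℕ.+ n) ≈ fromℕ m + fromℕ n
  fromℕ-+ m n rewrite fromℕ≡×1 m | fromℕ≡×1 n | fromℕ≡×1 (m ℕ.+ n) = ×-homo-+ 1# m n

  fromℕ-* : ∀ m n → fromℕ (m ℕ.* n) ≈ fromℕ m * fromℕ n
  fromℕ-* m n rewrite fromℕ≡×1 m | fromℕ≡×1 n | fromℕ≡×1 (m ℕ.* n) = ×1-homo-* m n

  sgn-+ : ∀ m n → sgn (m ℕ.+ n) ≈ sgn m * sgn n
  sgn-+ zero    n = sym (*-identityˡ (sgn n))
  sgn-+ (suc m) n = trans (-‿cong (sgn-+ m n)) (-‿distribˡ-* (sgn m) (sgn n))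

  sgn-2* : ∀ n → sgn (2 ℕ.* n) ≈ 1#
  sgn-2* zero    = refl
  sgn-2* (suc n) = trans (reflexive (≡.cong sgn (ℕP.*-suc 2 n))) (trans (⁻¹-involutive _) (sgn-2* n))

  sgn*sgn : ∀ n → sgn n * sgn n ≈ 1#
  sgn*sgn n = begin
    sgn n * sgn n     ≈⟨ sgn-+ n n ⟨
    sgn (n ℕ.+ n)     ≡⟨ ≡.cong (λ m → sgn (n ℕ.+ m)) (ℕP.+-identityʳ n) ⟨
    sgn (2 ℕ.* n)     ≈⟨ sgn-2* n ⟩
    1#                ∎

  sgn-*-odd : ∀ {m} → sgn m ≈ - 1# → ∀ n → sgn (m ℕ.* n) ≈ sgn n
  sgn-*-odd {m} sgn-m zero    = reflexive (≡.cong sgn (ℕP.*-zeroʳ m))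
  sgn-*-odd {m} sgn-m (suc n) = begin
    sgn (m ℕ.* suc n)     ≡⟨ ≡.cong sgn (ℕP.*-suc m n) ⟩
    sgn (m ℕ.+ m ℕ.* n)   ≈⟨ sgn-+ m (m ℕ.* n) ⟩
    sgn m * sgn (m ℕ.* n) ≈⟨ *-cong sgn-m (sgn-*-odd {m} sgn-m n) ⟩
    - 1# * sgn n          ≈⟨ -1*x≈-x (sgn n) ⟩
    sgn (suc n)           ∎

  sgn-^-odd : ∀ {m} → sgn m ≈ - 1# → ∀ k → sgn (m ℕ.^ k) ≈ - 1#
  sgn-^-odd sgn-m zero        = refl
  sgn-^-odd {m} sgn-m (suc k) = trans (sgn-*-odd {m} sgn-m (m ℕ.^ k)) (sgn-^-odd sgn-m k)

  ¬2∣⇒sgn≈-1 : ∀ {n} → ¬ 2 ∣ n → sgn n ≈ - 1#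
  ¬2∣⇒sgn≈-1 {zero}        ¬2∣n = ⊥-elim (¬2∣n (2 ∣0))
  ¬2∣⇒sgn≈-1 {suc zero}    _    = refl
  ¬2∣⇒sgn≈-1 {suc (suc n)} ¬2∣n =
    trans (⁻¹-involutive _) (¬2∣⇒sgn≈-1 (λ 2∣n → ¬2∣n (∣m∣n⇒∣m+n ∣-refl 2∣n)))

  +-−-interchange : ∀ x y z w → (x + y) - (z + w) ≈ (x - z) + (y - w)
  +-−-interchange x y z w = trans (+-congˡ (sym (⁻¹-∙-comm z w))) (interchange x y (- z) (- w))

  Σ<-cong : ∀ n {f g : ℕ → Carrier} → (∀ k → k ℕ.< n → f k ≈ g k) → Σ< n f ≈ Σ< n g
  Σ<-cong zero    f≈g = refl
  Σ<-cong (suc n) f≈g = +-cong (Σ<-cong n (λ k k<n → f≈g k (ℕP.m<n⇒m<1+n k<n))) (f≈g n ℕP.≤-refl)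

  Σ<-zero : ∀ n {f : ℕ → Carrier} → (∀ k → k ℕ.< n → f k ≈ 0#) → Σ< n f ≈ 0#
  Σ<-zero zero    f≈0 = refl
  Σ<-zero (suc n) f≈0 =
    trans (+-cong (Σ<-zero n (λ k k<n → f≈0 k (ℕP.m<n⇒m<1+n k<n))) (f≈0 n ℕP.≤-refl)) (+-identityʳ 0#)

  Σ<-− : ∀ n (f g : ℕ → Carrier) → Σ< n (λ k → f k - g k) ≈ Σ< n f - Σ< n g
  Σ<-− zero    f g = sym (-‿inverseʳ 0#)
  Σ<-− (suc n) f g = trans (+-congʳ (Σ<-− n f g)) (sym (+-−-interchange _ _ _ _))

  *-distribˡ-Σ< : ∀ n a (f : ℕ → Carrier) → a * Σ< n f ≈ Σ< n (λ k → a * f k)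
  *-distribˡ-Σ< zero    a f = zeroʳ a
  *-distribˡ-Σ< (suc n) a f = trans (distribˡ a _ _) (+-congʳ (*-distribˡ-Σ< n a f))

  Σ<-head : ∀ n (f : ℕ → Carrier) → Σ< (suc n) f ≈ f 0 + Σ< n (λ k → f (suc k))
  Σ<-head zero    f = +-comm 0# (f 0)
  Σ<-head (suc n) f = trans (+-congʳ (Σ<-head n f)) (+-assoc _ _ _)

  Σ<-truncate : ∀ {h n} (f : ℕ → Carrier) → h ℕ.≤ n → (∀ k → h ℕ.≤ k → k ℕ.< n → f k ≈ 0#) →
                Σ< n f ≈ Σ< h f
  Σ<-truncate {n = zero} f ℕ.z≤n _ = refl
  Σ<-truncate {n = suc n} f h≤1+n f≈0 with ℕP.m≤n⇒m<n∨m≡n h≤1+n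
  ... | inj₂ ≡.refl = refl
  ... | inj₁ h<1+n  = trans (+-cong (Σ<-truncate f h≤n (λ k h≤k k<n → f≈0 k h≤k (ℕP.m<n⇒m<1+n k<n)))
                                    (f≈0 n h≤n ℕP.≤-refl))
                            (+-identityʳ _)
    where h≤n = ℕP.≤-pred h<1+n

  Σ≤-entry : ∀ m (F : ℕ → Matrix) a b → Σ≤ m F a b ≈ Σ< (suc m) (λ i → F i a b)
  Σ≤-entry zero    F a b = sym (+-identityˡ _)
  Σ≤-entry (suc m) F a b = +-congʳ (Σ≤-entry m F a b)

  𝕀-diag : ∀ a → 𝕀 a a ≈ 1#
  𝕀-diag a with a ℕ.≟ a
  ... | yes _   = refl
  ... | no a≢a  = contradiction ≡.refl a≢a

  𝕀-off : ∀ {a b} → a ≢ b → 𝕀 a b ≈ 0#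
  𝕀-off {a} {b} a≢b with a ℕ.≟ b
  ... | yes a≡b = contradiction a≡b a≢b
  ... | no _    = refl

  Σ<-𝕀 : ∀ n {c} (f : ℕ → Carrier) → c ℕ.< n → Σ< n (λ k → 𝕀 c k * f k) ≈ f c
  Σ<-𝕀 (suc n) {c} f c<1+n with ℕP.m≤n⇒m<n∨m≡n (ℕP.≤-pred c<1+n)
  ... | inj₂ ≡.refl = trans (+-cong (Σ<-zero n off-diagonal) diagonal) (+-identityˡ _)
    where
    off-diagonal : ∀ k → k ℕ.< n → 𝕀 n k * f k ≈ 0#
    off-diagonal k k<n = trans (*-congʳ (𝕀-off (≡.≢-sym (ℕP.<⇒≢ k<n)))) (zeroˡ _)
    diagonal : 𝕀 n n * f n ≈ f n
    diagonal = trans (*-congʳ (𝕀-diag n)) (*-identityˡ _)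
  ... | inj₁ c<n    = trans (+-cong (Σ<-𝕀 n f c<n) (trans (*-congʳ (𝕀-off (ℕP.<⇒≢ c<n))) (zeroˡ _)))
                            (+-identityʳ _)

  Fn : Set c
  Fn = ℤ → Carrier

  _≗_ : Fn → Fn → Set ℓ
  f ≗ g = ∀ z → f z ≈ g z
  infix 4 _≗_

  δ : Fn
  δ (+ zero)  = 1#
  δ (+ suc _) = 0#
  δ -[1+ _ ]  = 0#

  δ-diff : ∀ a b → δ (+ a ℤ.- + b) ≈ 𝕀 a b
  δ-diff a b with a ℕ.≟ b
  ... | yes ≡.refl = reflexive (≡.cong δ (ℤP.+-inverseʳ (+ a)))
  ... | no a≢b     = δ-off (λ a-b≡0 → a≢b (ℤP.+-injective (ℤP.i-j≡0⇒i≡j _ _ a-b≡0)))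
    where
    δ-off : ∀ {z} → z ≢ + 0 → δ z ≈ 0#
    δ-off {+ zero}  z≢0 = contradiction ≡.refl z≢0
    δ-off {+ suc _} _   = refl
    δ-off { -[1+ _ ]} _ = refl

  Δ : ℕ → Fn → Fn
  Δ s f z = f (z ℤ.- + s) - f (z ℤ.+ + s)

  Δ^ : ℕ → ℕ → Fn → Fn
  Δ^ s zero    f = f
  Δ^ s (suc j) f = Δ s (Δ^ s j f)

  Δ-cong : ∀ s {f g} → f ≗ g → Δ s f ≗ Δ s g
  Δ-cong s f≗g z = +-cong (f≗g _) (-‿cong (f≗g _))

  Δ^-+ : ∀ s m n f → Δ^ s (m ℕ.+ n) f ≡ Δ^ s m (Δ^ s n f)
  Δ^-+ s zero    n f = ≡.refl
  Δ^-+ s (suc m) n f = ≡.cong (Δ s) (Δ^-+ s m n f)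

  Δ^-* : ∀ {s m t} → (∀ f → Δ^ s m f ≗ Δ t f) → ∀ j f → Δ^ s (m ℕ.* j) f ≗ Δ^ t j f
  Δ^-* {s} {m}     _   zero    f z = reflexive (≡.cong (λ i → Δ^ s i f z) (ℕP.*-zeroʳ m))
  Δ^-* {s} {m} {t} hyp (suc j) f z = begin
    Δ^ s (m ℕ.* suc j) f z        ≡⟨ ≡.cong (λ i → Δ^ s i f z) (ℕP.*-suc m j) ⟩
    Δ^ s (m ℕ.+ m ℕ.* j) f z      ≡⟨ ≡.cong-app (Δ^-+ s m (m ℕ.* j) f) z ⟩
    Δ^ s m (Δ^ s (m ℕ.* j) f) z   ≈⟨ hyp _ z ⟩
    Δ t (Δ^ s (m ℕ.* j) f) z      ≈⟨ Δ-cong t (Δ^-* {s} {m} hyp j f) z ⟩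
    Δ t (Δ^ t j f) z              ∎

  signedChoose : ℕ → ℕ → Carrier
  signedChoose j r = fromℕ (j C r) * sgn r

  signedChoose-0 : ∀ j → signedChoose j 0 ≈ 1#
  signedChoose-0 j = trans (*-identityʳ _) (+-identityʳ 1#)

  signedChoose-diag : ∀ j → signedChoose j j ≈ sgn j
  signedChoose-diag j = trans (*-congʳ (trans (reflexive (≡.cong fromℕ (nCn≡1 j))) (+-identityʳ 1#)))
                              (*-identityˡ _)

  signedChoose-beyond : ∀ j → signedChoose j (suc j) ≈ 0#
  signedChoose-beyond j = trans (*-congʳ (reflexive (≡.cong fromℕ (k>n⇒nCk≡0 (ℕP.n<1+n j))))) (zeroˡ _)

  signedChoose-suc : ∀ j r → signedChoose (suc j) (suc r) ≈ signedChoose j (suc r) - signedChoose j r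
  signedChoose-suc j r = begin
    fromℕ (suc j C suc r) * - sgn r
      ≡⟨ ≡.cong (λ n → fromℕ n * - sgn r) (nCk+nC[k+1]≡[n+1]C[k+1] j r) ⟨
    fromℕ (j C r ℕ.+ j C suc r) * - sgn r
      ≈⟨ *-congʳ (fromℕ-+ (j C r) (j C suc r)) ⟩
    (fromℕ (j C r) + fromℕ (j C suc r)) * - sgn r
      ≈⟨ trans (distribʳ _ _ _) (+-comm _ _) ⟩
    fromℕ (j C suc r) * - sgn r + fromℕ (j C r) * - sgn r
      ≈⟨ +-congˡ (-‿distribʳ-* _ _) ⟨
    signedChoose j (suc r) - signedChoose j r
      ∎

  Σ<-pascal : ∀ j (g : ℕ → Carrier) →
    Σ< (suc j) (λ r → signedChoose j r * g r) - Σ< (suc j) (λ r → signedChoose j r * g (suc r))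
      ≈ Σ< (suc (suc j)) (λ r → signedChoose (suc j) r * g r)
  Σ<-pascal j g = begin
    Σ< (suc j) u - Σ< (suc j) v
      ≈⟨ +-congʳ (trans (+-congˡ u-beyond) (+-identityʳ _)) ⟨
    Σ< (suc (suc j)) u - Σ< (suc j) v
      ≈⟨ +-congʳ (Σ<-head (suc j) u) ⟩
    (u 0 + Σ< (suc j) (λ r → u (suc r))) - Σ< (suc j) v
      ≈⟨ +-assoc _ _ _ ⟩
    u 0 + (Σ< (suc j) (λ r → u (suc r)) - Σ< (suc j) v)
      ≈⟨ +-congˡ (Σ<-− (suc j) (λ r → u (suc r)) v) ⟨
    u 0 + Σ< (suc j) (λ r → u (suc r) - v r)
      ≈⟨ +-cong (*-congʳ (trans (signedChoose-0 j) (sym (signedChoose-0 (suc j)))))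
                (Σ<-cong (suc j) (λ r _ → sym (w[1+r]≈u[1+r]-v[r] r))) ⟩
    w 0 + Σ< (suc j) (λ r → w (suc r))
      ≈⟨ Σ<-head (suc j) w ⟨
    Σ< (suc (suc j)) w
      ∎
    where
    u v w : ℕ → Carrier
    u r = signedChoose j r * g r
    v r = signedChoose j r * g (suc r)
    w r = signedChoose (suc j) r * g r
    u-beyond : u (suc j) ≈ 0#
    u-beyond = trans (*-congʳ (signedChoose-beyond j)) (zeroˡ _)
    w[1+r]≈u[1+r]-v[r] : ∀ r → w (suc r) ≈ u (suc r) - v r
    w[1+r]≈u[1+r]-v[r] r = trans (*-congʳ (signedChoose-suc j r)) ([y-z]x≈yx-zx _ _ _)

  Δ^-expansion : ∀ s j f z →
    Δ^ s j f z ≈ Σ< (suc j) (λ r → signedChoose j r * f (z ℤ.- + s ℤ.* (+ j ℤ.- + (2 ℕ.* r))))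
  Δ^-expansion s zero f z = sym (begin
    0# + signedChoose 0 0 * f (z ℤ.- + s ℤ.* + 0) ≈⟨ +-identityˡ _ ⟩
    signedChoose 0 0 * f (z ℤ.- + s ℤ.* + 0)      ≈⟨ trans (*-congʳ (signedChoose-0 0)) (*-identityˡ _) ⟩
    f (z ℤ.- + s ℤ.* + 0)                         ≡⟨ ≡.cong f (z-s*0≡z z (+ s)) ⟩
    f z                                           ∎)
    where
    z-s*0≡z : ∀ z s → z ℤ.- s ℤ.* + 0 ≡ z
    z-s*0≡z = solve-∀
  Δ^-expansion s (suc j) f z = begin
    Δ^ s j f (z ℤ.- + s) - Δ^ s j f (z ℤ.+ + s)
      ≈⟨ +-cong (Δ^-expansion s j f _) (-‿cong (Δ^-expansion s j f _)) ⟩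
    Σ< (suc j) (λ r → signedChoose j r * f ((z ℤ.- + s) ℤ.- + s ℤ.* (+ j ℤ.- + (2 ℕ.* r))))
      - Σ< (suc j) (λ r → signedChoose j r * f ((z ℤ.+ + s) ℤ.- + s ℤ.* (+ j ℤ.- + (2 ℕ.* r))))
      ≈⟨ +-cong (Σ<-cong (suc j) (λ r _ → *-congˡ (reflexive (≡.cong f (shift-left r)))))
                (-‿cong (Σ<-cong (suc j) (λ r _ → *-congˡ (reflexive (≡.cong f (shift-right r)))))) ⟩
    Σ< (suc j) (λ r → signedChoose j r * g r) - Σ< (suc j) (λ r → signedChoose j r * g (suc r))
      ≈⟨ Σ<-pascal j g ⟩
    Σ< (suc (suc j)) (λ r → signedChoose (suc j) r * g r)
      ∎
    where
    g : ℕ → Carrier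
    g r = f (z ℤ.- + s ℤ.* (+ suc j ℤ.- + (2 ℕ.* r)))
    [z-s]-s[j-t]≡z-s[1+j-t] : ∀ z s j t →
      (z ℤ.- s) ℤ.- s ℤ.* (j ℤ.- t) ≡ z ℤ.- s ℤ.* ((+ 1 ℤ.+ j) ℤ.- t)
    [z-s]-s[j-t]≡z-s[1+j-t] = solve-∀
    [z+s]-s[j-t]≡z-s[1+j-2-t] : ∀ z s j t →
      (z ℤ.+ s) ℤ.- s ℤ.* (j ℤ.- t) ≡ z ℤ.- s ℤ.* ((+ 1 ℤ.+ j) ℤ.- (+ 2 ℤ.+ t))
    [z+s]-s[j-t]≡z-s[1+j-2-t] = solve-∀
    shift-left : ∀ r → (z ℤ.- + s) ℤ.- + s ℤ.* (+ j ℤ.- + (2 ℕ.* r))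
                     ≡ z ℤ.- + s ℤ.* (+ suc j ℤ.- + (2 ℕ.* r))
    shift-left r = [z-s]-s[j-t]≡z-s[1+j-t] z (+ s) (+ j) (+ (2 ℕ.* r))
    shift-right : ∀ r → (z ℤ.+ + s) ℤ.- + s ℤ.* (+ j ℤ.- + (2 ℕ.* r))
                      ≡ z ℤ.- + s ℤ.* (+ suc j ℤ.- + (2 ℕ.* suc r))
    shift-right r = ≡.trans ([z+s]-s[j-t]≡z-s[1+j-2-t] z (+ s) (+ j) (+ (2 ℕ.* r)))
                            (≡.cong (λ t → z ℤ.- + s ℤ.* (+ suc j ℤ.- + t)) (≡.sym (ℕP.*-suc 2 r)))

  InnerChooseVanishes : ℕ → Set ℓ
  InnerChooseVanishes p = ∀ {r} → 0 ℕ.< r → r ℕ.< p → fromℕ (p C r) ≈ 0#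

  -- Only the two extreme terms of the binomial expansion survive.
  Δ^-frobenius : ∀ {p} → ¬ 2 ∣ p → InnerChooseVanishes p → ∀ s f → Δ^ s p f ≗ Δ (s ℕ.* p) f
  Δ^-frobenius {zero}  p-odd _     s f z = ⊥-elim (p-odd (2 ∣0))
  Δ^-frobenius {suc q} p-odd pCr≈0 s f z = begin
    Δ^ s p f z                                  ≈⟨ Δ^-expansion s p f z ⟩
    Σ< p t + t p                                ≈⟨ +-congʳ (Σ<-head q t) ⟩
    (t 0 + Σ< q (λ r → t (suc r))) + t p        ≈⟨ +-congʳ (+-congˡ (Σ<-zero q t-inner)) ⟩
    (t 0 + 0#) + t p                            ≈⟨ +-cong (trans (+-identityʳ _) t-first) t-last ⟩
    f (z ℤ.- + (s ℕ.* p)) - f (z ℤ.+ + (s ℕ.* p)) ∎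
    where
    p = suc q
    t : ℕ → Carrier
    t r = signedChoose p r * f (z ℤ.- + s ℤ.* (+ p ℤ.- + (2 ℕ.* r)))
    t-inner : ∀ r → r ℕ.< q → t (suc r) ≈ 0#
    t-inner r r<q = trans (*-congʳ (trans (*-congʳ (pCr≈0 (ℕ.s≤s ℕ.z≤n) (ℕ.s≤s r<q))) (zeroˡ _))) (zeroˡ _)
    z-s[p-0]≡z-sp : ∀ z s p → z ℤ.- s ℤ.* (p ℤ.- + 0) ≡ z ℤ.- s ℤ.* p
    z-s[p-0]≡z-sp = solve-∀
    z-s[p-2p]≡z+sp : ∀ z s p → z ℤ.- s ℤ.* (p ℤ.- + 2 ℤ.* p) ≡ z ℤ.+ s ℤ.* p
    z-s[p-2p]≡z+sp = solve-∀
    first : z ℤ.- + s ℤ.* (+ p ℤ.- + 0) ≡ z ℤ.- + (s ℕ.* p)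
    first = ≡.trans (z-s[p-0]≡z-sp z (+ s) (+ p)) (≡.cong (λ x → z ℤ.- x) (≡.sym (ℤP.pos-* s p)))
    last : z ℤ.- + s ℤ.* (+ p ℤ.- + (2 ℕ.* p)) ≡ z ℤ.+ + (s ℕ.* p)
    last = ≡.trans (≡.cong (λ x → z ℤ.- + s ℤ.* (+ p ℤ.- x)) (ℤP.pos-* 2 p))
                   (≡.trans (z-s[p-2p]≡z+sp z (+ s) (+ p)) (≡.cong (λ x → z ℤ.+ x) (≡.sym (ℤP.pos-* s p))))
    t-first : t 0 ≈ f (z ℤ.- + (s ℕ.* p))
    t-first = trans (*-congʳ (signedChoose-0 p)) (trans (*-identityˡ _) (reflexive (≡.cong f first)))
    t-last : t p ≈ - f (z ℤ.+ + (s ℕ.* p))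
    t-last = trans (*-cong (trans (signedChoose-diag p) (¬2∣⇒sgn≈-1 p-odd)) (reflexive (≡.cong f last)))
                   (-1*x≈-x _)

  Δ^-frobenius-^ : ∀ {p} → ¬ 2 ∣ p → InnerChooseVanishes p →
                   ∀ k s f → Δ^ s (p ℕ.^ k) f ≗ Δ (s ℕ.* p ℕ.^ k) f
  Δ^-frobenius-^     p-odd pCr≈0 zero    s f z =
    reflexive (≡.cong (λ t → Δ t f z) (≡.sym (ℕP.*-identityʳ s)))
  Δ^-frobenius-^ {p} p-odd pCr≈0 (suc k) s f z = begin
    Δ^ s (p ℕ.* p ℕ.^ k) f z    ≈⟨ Δ^-* {s} {p} (Δ^-frobenius p-odd pCr≈0 s) (p ℕ.^ k) f z ⟩
    Δ^ (s ℕ.* p) (p ℕ.^ k) f z  ≈⟨ Δ^-frobenius-^ p-odd pCr≈0 k (s ℕ.* p) f z ⟩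
    Δ (s ℕ.* p ℕ.* p ℕ.^ k) f z ≡⟨ ≡.cong (λ t → Δ t f z) (ℕP.*-assoc s p (p ℕ.^ k)) ⟩
    Δ (s ℕ.* (p ℕ.* p ℕ.^ k)) f z ∎

  A·-row₀ : ∀ M b → (A-rf · M) 0 b ≈ - M 1 b
  A·-row₀ M b = begin
    (0# + (0# - 0#) * M 0 b) + (0# - 1#) * M 1 b
      ≈⟨ +-cong (trans (+-identityˡ _) (trans (*-congʳ (-‿inverseʳ 0#)) (zeroˡ _))) (*-congʳ (+-identityˡ _)) ⟩
    0# + - 1# * M 1 b
      ≈⟨ trans (+-identityˡ _) (-1*x≈-x _) ⟩
    - M 1 b ∎

  A·-rowₛ : ∀ M a b → (A-rf · M) (suc a) b ≈ M a b - M (2 ℕ.+ a) b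
  A·-rowₛ M a b = begin
    Σ< (3 ℕ.+ a) (λ k → (𝕀 a k - 𝕀 (2 ℕ.+ a) k) * M k b)
      ≈⟨ Σ<-cong (3 ℕ.+ a) (λ k _ → [y-z]x≈yx-zx _ _ _) ⟩
    Σ< (3 ℕ.+ a) (λ k → 𝕀 a k * M k b - 𝕀 (2 ℕ.+ a) k * M k b)
      ≈⟨ Σ<-− (3 ℕ.+ a) (λ k → 𝕀 a k * M k b) (λ k → 𝕀 (2 ℕ.+ a) k * M k b) ⟩
    Σ< (3 ℕ.+ a) (λ k → 𝕀 a k * M k b) - Σ< (3 ℕ.+ a) (λ k → 𝕀 (2 ℕ.+ a) k * M k b)
      ≈⟨ +-cong (Σ<-𝕀 (3 ℕ.+ a) (λ k → M k b) (ℕP.m≤n+m (suc a) 2))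
                (-‿cong (Σ<-𝕀 (3 ℕ.+ a) (λ k → M k b) ℕP.≤-refl)) ⟩
    M a b - M (2 ℕ.+ a) b ∎

  -- The source b mirrored in the virtual row −1 sits at −b − 2, whence the offset a + b + 2.
  reflect : Fn → Matrix
  reflect f a b = f (+ a ℤ.- + b) + sgn b * f (+ (2 ℕ.+ a ℕ.+ b))

  Reflective : Fn → Set ℓ
  Reflective f = ∀ d → f (ℤ.- + d) ≈ sgn d * f (+ d)

  δ-reflective : Reflective δ
  δ-reflective zero    = sym (*-identityˡ 1#)
  δ-reflective (suc d) = sym (zeroʳ _)

  Δ-reflective : ∀ {f} → Reflective f → Reflective (Δ 1 f)
  Δ-reflective f-refl zero        = sym (*-identityˡ _)
  Δ-reflective {f} f-refl (suc d) = begin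
    f (ℤ.- + suc d ℤ.- + 1) - f (ℤ.- + suc d ℤ.+ + 1)
      ≈⟨ +-cong (reflexive (≡.cong f (-[1+x]-1≡-[2+x] (+ d))))
                (-‿cong (reflexive (≡.cong f (-[1+x]+1≡-x (+ d))))) ⟩
    f (ℤ.- + (2 ℕ.+ d)) - f (ℤ.- + d)
      ≈⟨ +-cong (f-refl (2 ℕ.+ d)) (-‿cong (f-refl d)) ⟩
    sgn (2 ℕ.+ d) * f (+ (2 ℕ.+ d)) - sgn d * f (+ d)
      ≈⟨ +-congʳ (*-congʳ (⁻¹-involutive _)) ⟩
    sgn d * f (+ (2 ℕ.+ d)) - sgn d * f (+ d)
      ≈⟨ x[y-z]≈xy-xz _ _ _ ⟨
    sgn d * (f (+ (2 ℕ.+ d)) - f (+ d))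
      ≈⟨ *-congˡ (⁻¹-anti-homo‿- _ _) ⟨
    sgn d * - (f (+ d) - f (+ (2 ℕ.+ d)))
      ≈⟨ -‿distribʳ-* _ _ ⟨
    - (sgn d * (f (+ d) - f (+ (2 ℕ.+ d))))
      ≈⟨ -‿distribˡ-* _ _ ⟩
    sgn (suc d) * (f (+ d) - f (+ (2 ℕ.+ d)))
      ≡⟨ ≡.cong (λ x → sgn (suc d) * (f (+ d) - f (+ x))) (ℕP.+-comm 1 (suc d)) ⟩
    sgn (suc d) * (f (+ suc d ℤ.- + 1) - f (+ suc d ℤ.+ + 1)) ∎
    where
    -[1+x]-1≡-[2+x] : ∀ x → ℤ.- (+ 1 ℤ.+ x) ℤ.- + 1 ≡ ℤ.- (+ 2 ℤ.+ x)
    -[1+x]-1≡-[2+x] = solve-∀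
    -[1+x]+1≡-x : ∀ x → ℤ.- (+ 1 ℤ.+ x) ℤ.+ + 1 ≡ ℤ.- x
    -[1+x]+1≡-x = solve-∀

  Δ₁^-reflective : ∀ N → Reflective (Δ^ 1 N δ)
  Δ₁^-reflective zero    = δ-reflective
  Δ₁^-reflective (suc N) = Δ-reflective {Δ^ 1 N δ} (Δ₁^-reflective N)

  reflect-rowₛ : ∀ f a b → reflect f a b - reflect f (2 ℕ.+ a) b ≈ reflect (Δ 1 f) (suc a) b
  reflect-rowₛ f a b = begin
    (f (+ a ℤ.- + b) + sgn b * f (+ (2 ℕ.+ a ℕ.+ b)))
      - (f (+ (2 ℕ.+ a) ℤ.- + b) + sgn b * f (+ (4 ℕ.+ a ℕ.+ b)))
      ≈⟨ +-−-interchange _ _ _ _ ⟩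
    (f (+ a ℤ.- + b) - f (+ (2 ℕ.+ a) ℤ.- + b))
      + (sgn b * f (+ (2 ℕ.+ a ℕ.+ b)) - sgn b * f (+ (4 ℕ.+ a ℕ.+ b)))
      ≈⟨ +-congˡ (x[y-z]≈xy-xz _ _ _) ⟨
    (f (+ a ℤ.- + b) - f (+ (2 ℕ.+ a) ℤ.- + b))
      + sgn b * (f (+ (2 ℕ.+ a ℕ.+ b)) - f (+ (4 ℕ.+ a ℕ.+ b)))
      ≈⟨ +-cong (+-cong (reflexive (≡.cong f (≡.sym ([1+x-y]-1≡x-y (+ a) (+ b)))))
                        (-‿cong (reflexive (≡.cong f (≡.sym ([1+x-y]+1≡2+x-y (+ a) (+ b)))))))
                (*-congˡ (+-congˡ (-‿cong (reflexive (≡.cong (λ x → f (+ x)) (ℕP.+-comm 1 (3 ℕ.+ a ℕ.+ b))))))) ⟩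
    reflect (Δ 1 f) (suc a) b ∎
    where
    [1+x-y]-1≡x-y : ∀ x y → (+ 1 ℤ.+ x) ℤ.- y ℤ.- + 1 ≡ x ℤ.- y
    [1+x-y]-1≡x-y = solve-∀
    [1+x-y]+1≡2+x-y : ∀ x y → (+ 1 ℤ.+ x) ℤ.- y ℤ.+ + 1 ≡ (+ 2 ℤ.+ x) ℤ.- y
    [1+x-y]+1≡2+x-y = solve-∀

  reflect-row₀ : ∀ {f} → Reflective f → ∀ b → - reflect f 1 b ≈ reflect (Δ 1 f) 0 b
  reflect-row₀ {f} f-refl b = begin
    - (u + s * v)                         ≈⟨ +-identityˡ _ ⟨
    0# - (u + s * v)                      ≈⟨ +-congʳ (-‿inverseˡ (s * w)) ⟨
    (- (s * w) + s * w) - (u + s * v)     ≈⟨ +-−-interchange _ _ _ _ ⟩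
    (- (s * w) - u) + (s * w - s * v)     ≈⟨ +-cong (+-congʳ (-‿distribˡ-* s w)) (sym (x[y-z]≈xy-xz s w v)) ⟩
    (- s * w - u) + s * (w - v)
      ≈⟨ +-cong (+-cong (sym (trans (reflexive (≡.cong f (-b-1≡-[1+b] (+ b)))) (f-refl (suc b))))
                        (-‿cong (reflexive (≡.cong f (≡.sym (-b+1≡1-b (+ b)))))))
                (*-congˡ (+-congˡ (-‿cong (reflexive (≡.cong (λ x → f (+ x)) (ℕP.+-comm 1 (2 ℕ.+ b))))))) ⟩
    reflect (Δ 1 f) 0 b                   ∎
    where
    s = sgn b
    u = f (+ 1 ℤ.- + b)
    v = f (+ (3 ℕ.+ b))
    w = f (+ suc b)
    -b-1≡-[1+b] : ∀ y → (+ 0 ℤ.- y) ℤ.- + 1 ≡ ℤ.- (+ 1 ℤ.+ y)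
    -b-1≡-[1+b] = solve-∀
    -b+1≡1-b : ∀ y → (+ 0 ℤ.- y) ℤ.+ + 1 ≡ + 1 ℤ.- y
    -b+1≡1-b = solve-∀

  A^≋reflect : ∀ N → A-rf ^^ N ≋ reflect (Δ^ 1 N δ)
  A^≋reflect zero    a       b = sym (trans (+-cong (δ-diff a b) (zeroʳ _)) (+-identityʳ _))
  A^≋reflect (suc N) zero    b =
    trans (A·-row₀ (A-rf ^^ N) b)
          (trans (-‿cong (A^≋reflect N 1 b)) (reflect-row₀ {Δ^ 1 N δ} (Δ₁^-reflective N) b))
  A^≋reflect (suc N) (suc a) b =
    trans (A·-rowₛ (A-rf ^^ N) a b)
          (trans (+-cong (A^≋reflect N a b) (-‿cong (A^≋reflect N (2 ℕ.+ a) b)))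
                 (reflect-rowₛ (Δ^ 1 N δ) a b))

  ⊖-iter : ∀ m (M : Matrix) a b → iter m ⊖ M a b ≡ M (m ℕ.+ a) b
  ⊖-iter zero    M a b = ≡.refl
  ⊖-iter (suc m) M a b = ≡.trans (⊖-iter m M (suc a) b) (≡.cong (λ i → M i b) (ℕP.+-suc m a))

  ⊕^-𝕀 : ∀ z a b → ⊕^ z 𝕀 a b ≈ δ ((+ a ℤ.- + b) ℤ.- z)
  ⊕^-𝕀 (+ zero)    a       b =
    sym (trans (reflexive (≡.cong δ (ℤP.+-identityʳ (+ a ℤ.- + b)))) (δ-diff a b))
  ⊕^-𝕀 (+ suc m)   zero    b = reflexive (≡.cong δ (≡.sym (-y-[1+w]≡-[1+w+y] (+ b) (+ m))))
    where
    -y-[1+w]≡-[1+w+y] : ∀ y w → (+ 0 ℤ.- y) ℤ.- (+ 1 ℤ.+ w) ≡ ℤ.- (+ 1 ℤ.+ (w ℤ.+ y))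
    -y-[1+w]≡-[1+w+y] = solve-∀
  ⊕^-𝕀 (+ suc m)   (suc a) b =
    trans (⊕^-𝕀 (+ m) a b) (reflexive (≡.cong δ (x-y-w≡[1+x]-y-[1+w] (+ a) (+ b) (+ m))))
    where
    x-y-w≡[1+x]-y-[1+w] : ∀ x y w → x ℤ.- y ℤ.- w ≡ (+ 1 ℤ.+ x) ℤ.- y ℤ.- (+ 1 ℤ.+ w)
    x-y-w≡[1+x]-y-[1+w] = solve-∀
  ⊕^-𝕀 -[1+ m ]    a       b =
    trans (reflexive (⊖-iter (suc m) 𝕀 a b))
          (trans (sym (δ-diff (suc m ℕ.+ a) b)) (reflexive (≡.cong δ ([1+w+x]-y≡x-y+[1+w] (+ a) (+ b) (+ m)))))
    where
    [1+w+x]-y≡x-y+[1+w] : ∀ x y w → ((+ 1 ℤ.+ w) ℤ.+ x) ℤ.- y ≡ (x ℤ.- y) ℤ.- ℤ.- (+ 1 ℤ.+ w)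
    [1+w+x]-y≡x-y+[1+w] = solve-∀

  J-on : ∀ {L a b} → suc (a ℕ.+ b) ≡ L → J L a b ≈ sgn a
  J-on {L} {a} {b} 1+a+b≡L with suc (a ℕ.+ b) ℕ.≟ L
  ... | yes _        = refl
  ... | no 1+a+b≢L   = contradiction 1+a+b≡L 1+a+b≢L

  J-off : ∀ {L a b} → suc (a ℕ.+ b) ≢ L → J L a b ≈ 0#
  J-off {L} {a} {b} 1+a+b≢L with suc (a ℕ.+ b) ℕ.≟ L
  ... | yes 1+a+b≡L  = contradiction 1+a+b≡L 1+a+b≢L
  ... | no _         = refl

  -- The mirror point a + b + 2 hits the source L exactly when J_{L-1} has a nonzero (a, b) entry.
  mirror-δ≈J : ∀ L a b → sgn b * δ (+ (2 ℕ.+ a ℕ.+ b) ℤ.- + L) ≈ sgn L * J (L ℕ.∸ 1) a b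
  mirror-δ≈J L a b with 2 ℕ.+ a ℕ.+ b ℕ.≟ L
  ... | yes ≡.refl = begin
    sgn b * δ (+ (2 ℕ.+ a ℕ.+ b) ℤ.- + (2 ℕ.+ a ℕ.+ b))
      ≈⟨ trans (*-congˡ (trans (δ-diff X X) (𝕀-diag X))) (*-identityʳ _) ⟩
    sgn b                                      ≈⟨ *-identityˡ _ ⟨
    1# * sgn b                                 ≈⟨ *-congʳ (sgn*sgn a) ⟨
    (sgn a * sgn a) * sgn b                    ≈⟨ *-assoc _ _ _ ⟩
    sgn a * (sgn a * sgn b)                    ≈⟨ *-comm _ _ ⟩
    (sgn a * sgn b) * sgn a
      ≈⟨ *-cong (trans (⁻¹-involutive _) (sgn-+ a b)) (J-on {X ℕ.∸ 1} {a} {b} ≡.refl) ⟨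
    sgn (2 ℕ.+ a ℕ.+ b) * J (suc (a ℕ.+ b)) a b ∎
    where X = 2 ℕ.+ a ℕ.+ b
  ... | no 2+a+b≢L = trans (*-congˡ (trans (δ-diff (2 ℕ.+ a ℕ.+ b) L) (𝕀-off 2+a+b≢L)))
                           (trans (zeroʳ _)
                                  (sym (trans (*-congˡ (J-off {L ℕ.∸ 1} {a} {b} (1+a+b≢L∸1 2+a+b≢L))) (zeroʳ _))))
    where
    1+a+b≢L∸1 : ∀ {L} → 2 ℕ.+ a ℕ.+ b ≢ L → suc (a ℕ.+ b) ≢ L ℕ.∸ 1
    1+a+b≢L∸1 {zero}  _        ()
    1+a+b≢L∸1 {suc _} 2+a+b≢L 1+a+b≡L∸1 = 2+a+b≢L (≡.cong suc 1+a+b≡L∸1)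

  mirror-term-beyond : ∀ n {l r} a b → l ℕ.≤ 2 ℕ.* r →
    δ (+ (2 ℕ.+ a ℕ.+ b) ℤ.- + n ℤ.* (+ l ℤ.- + (2 ℕ.* r))) ≈ 0#
  mirror-term-beyond n {l} {r} a b l≤2r = reflexive (≡.cong δ X-n[l-2r]≡X+nE)
    where
    X = + (2 ℕ.+ a ℕ.+ b)
    E = 2 ℕ.* r ℕ.∸ l
    x-n[-e]≡x+ne : ∀ x n e → x ℤ.- n ℤ.* ℤ.- e ≡ x ℤ.+ n ℤ.* e
    x-n[-e]≡x+ne = solve-∀
    l-2r≡-E : + l ℤ.- + (2 ℕ.* r) ≡ ℤ.- + E
    l-2r≡-E = ≡.trans (ℤP.m-n≡m⊖n l (2 ℕ.* r))
                      (≡.trans (ℤP.⊖-swap l (2 ℕ.* r)) (≡.cong ℤ.-_ (ℤP.⊖-≥ l≤2r)))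
    X-n[l-2r]≡X+nE : X ℤ.- + n ℤ.* (+ l ℤ.- + (2 ℕ.* r)) ≡ + (2 ℕ.+ a ℕ.+ b ℕ.+ n ℕ.* E)
    X-n[l-2r]≡X+nE = ≡.trans (≡.cong (λ x → X ℤ.- + n ℤ.* x) l-2r≡-E)
                             (≡.trans (x-n[-e]≡x+ne X (+ n) (+ E)) (≡.cong (λ x → X ℤ.+ x) (≡.sym (ℤP.pos-* n E))))

  module _ {n : ℕ} (n-odd : sgn n ≈ - 1#) where

    mirror-term : ∀ {l r} a b → 2 ℕ.* r ℕ.≤ l →
      sgn b * δ (+ (2 ℕ.+ a ℕ.+ b) ℤ.- + n ℤ.* (+ l ℤ.- + (2 ℕ.* r)))
        ≈ sgn l * J (n ℕ.* (l ℕ.∸ 2 ℕ.* r) ℕ.∸ 1) a b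
    mirror-term {l} {r} a b 2r≤l = begin
      sgn b * δ (X ℤ.- + n ℤ.* (+ l ℤ.- + (2 ℕ.* r)))
        ≡⟨ ≡.cong (λ x → sgn b * δ (X ℤ.- x)) n[l-2r]≡nD ⟩
      sgn b * δ (X ℤ.- + (n ℕ.* D))             ≈⟨ mirror-δ≈J (n ℕ.* D) a b ⟩
      sgn (n ℕ.* D) * J (n ℕ.* D ℕ.∸ 1) a b     ≈⟨ *-congʳ (trans (sgn-*-odd {n} n-odd D) sgn-D) ⟩
      sgn l * J (n ℕ.* D ℕ.∸ 1) a b             ∎
      where
      X = + (2 ℕ.+ a ℕ.+ b)
      D = l ℕ.∸ 2 ℕ.* r
      n[l-2r]≡nD : + n ℤ.* (+ l ℤ.- + (2 ℕ.* r)) ≡ + (n ℕ.* D)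
      n[l-2r]≡nD = ≡.trans (≡.cong (λ x → + n ℤ.* x) (≡.trans (ℤP.m-n≡m⊖n l (2 ℕ.* r)) (ℤP.⊖-≥ 2r≤l)))
                           (≡.sym (ℤP.pos-* n D))
      sgn-D : sgn D ≈ sgn l
      sgn-D = begin
        sgn D                      ≈⟨ *-identityˡ _ ⟨
        1# * sgn D                 ≈⟨ *-congʳ (sgn-2* r) ⟨
        sgn (2 ℕ.* r) * sgn D      ≈⟨ sgn-+ (2 ℕ.* r) D ⟨
        sgn (2 ℕ.* r ℕ.+ D)        ≡⟨ ≡.cong sgn (ℕP.m+[n∸m]≡n 2r≤l) ⟩
        sgn l                      ∎

    -- The mirror image of a term with l ≤ 2r lies at a positive offset from row 0 and vanishes;
    -- h is any cut-off separating these from the terms with 2r ≤ l.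
    mirror-sum : ∀ {l h} a b → h ℕ.≤ suc l →
      (∀ r → r ℕ.< h → 2 ℕ.* r ℕ.≤ l) → (∀ r → h ℕ.≤ r → l ℕ.≤ 2 ℕ.* r) →
      sgn b * Σ< (suc l) (λ r → signedChoose l r * δ (+ (2 ℕ.+ a ℕ.+ b) ℤ.- + n ℤ.* (+ l ℤ.- + (2 ℕ.* r))))
        ≈ sgn l * Σ< h (λ r → signedChoose l r * J (n ℕ.* (l ℕ.∸ 2 ℕ.* r) ℕ.∸ 1) a b)
    mirror-sum {l} {h} a b h≤1+l below above = begin
      sgn b * Σ< (suc l) t              ≈⟨ *-distribˡ-Σ< (suc l) (sgn b) t ⟩
      Σ< (suc l) (λ r → sgn b * t r)    ≈⟨ Σ<-truncate (λ r → sgn b * t r) h≤1+l t-beyond ⟩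
      Σ< h (λ r → sgn b * t r)          ≈⟨ Σ<-cong h (λ r r<h → t≈J r (below r r<h)) ⟩
      Σ< h (λ r → sgn l * u r)          ≈⟨ *-distribˡ-Σ< h (sgn l) u ⟨
      sgn l * Σ< h u                    ∎
      where
      t u : ℕ → Carrier
      t r = signedChoose l r * δ (+ (2 ℕ.+ a ℕ.+ b) ℤ.- + n ℤ.* (+ l ℤ.- + (2 ℕ.* r)))
      u r = signedChoose l r * J (n ℕ.* (l ℕ.∸ 2 ℕ.* r) ℕ.∸ 1) a b
      t-beyond : ∀ r → h ℕ.≤ r → r ℕ.< suc l → sgn b * t r ≈ 0#
      t-beyond r h≤r _ =
        trans (*-congˡ (trans (*-congˡ (mirror-term-beyond n {l} {r} a b (above r h≤r))) (zeroʳ _))) (zeroʳ _)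
      t≈J : ∀ r → 2 ℕ.* r ℕ.≤ l → sgn b * t r ≈ sgn l * u r
      t≈J r 2r≤l =
        trans (x∙yz≈y∙xz _ _ _) (trans (*-congˡ (mirror-term {l} {r} a b 2r≤l)) (x∙yz≈y∙xz _ _ _))

    A^[n*l]-entry : (∀ f → Δ^ 1 n f ≗ Δ n f) → ∀ {l h} → h ℕ.≤ suc l →
      (∀ r → r ℕ.< h → 2 ℕ.* r ℕ.≤ l) → (∀ r → h ℕ.≤ r → l ℕ.≤ 2 ℕ.* r) → ∀ a b →
      (A-rf ^^ (n ℕ.* l)) a b
        ≈ Σ≤ l (λ i → signedChoose l i ⊙ ⊕^ (+ n ℤ.* (+ l ℤ.- + (2 ℕ.* i))) 𝕀) a b
          + sgn l * Σ< h (λ i → signedChoose l i * J (n ℕ.* (l ℕ.∸ 2 ℕ.* i) ℕ.∸ 1) a b)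
    A^[n*l]-entry Δ₁^n≗Δn {l} {h} h≤1+l below above a b = begin
      (A-rf ^^ (n ℕ.* l)) a b
        ≈⟨ A^≋reflect (n ℕ.* l) a b ⟩
      reflect (Δ^ 1 (n ℕ.* l) δ) a b
        ≈⟨ +-cong (Δ^-* {1} {n} Δ₁^n≗Δn l δ _) (*-congˡ (Δ^-* {1} {n} Δ₁^n≗Δn l δ _)) ⟩
      reflect (Δ^ n l δ) a b
        ≈⟨ +-cong (Δ^-expansion n l δ _) (*-congˡ (Δ^-expansion n l δ _)) ⟩
      Σ< (suc l) (λ r → signedChoose l r * δ ((+ a ℤ.- + b) ℤ.- + n ℤ.* (+ l ℤ.- + (2 ℕ.* r))))
        + sgn b * Σ< (suc l) (λ r → signedChoose l r * δ (+ (2 ℕ.+ a ℕ.+ b) ℤ.- + n ℤ.* (+ l ℤ.- + (2 ℕ.* r))))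
        ≈⟨ +-cong (sym (trans (Σ≤-entry l _ a b) (Σ<-cong (suc l) (λ i _ → *-congˡ (⊕^-𝕀 _ a b)))))
                  (mirror-sum a b h≤1+l below above) ⟩
      Σ≤ l (λ i → signedChoose l i ⊙ ⊕^ (+ n ℤ.* (+ l ℤ.- + (2 ℕ.* i))) 𝕀) a b
        + sgn l * Σ< h (λ i → signedChoose l i * J (n ℕ.* (l ℕ.∸ 2 ℕ.* i) ℕ.∸ 1) a b) ∎

open import Data.Nat using (_+_; _*_; _∸_; _^_; _≤_; _<_)
open import Data.Product using (_×_; _,_)

module OddCharacteristic {c ℓ : Level} (R : CommutativeRing c ℓ)
                         {p : ℕ} (p-prime : Prime p) (2<p : 2 < p) (char-p : FieldDefs.HasCharacteristic R p)
                         where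
  open CommutativeRing R
    using (_≈_; 1#; -_; sym; trans; reflexive; +-cong; +-congˡ; -‿cong; *-cong; *-congˡ; *-congʳ;
           *-identityˡ; zeroʳ; ring)
    renaming (_*_ to _*ᴿ_)
  open import Algebra.Properties.Ring ring using (-1*x≈-x)
  open MatrixDefs R
  open ShiftDifferencePowers R

  p-odd : ¬ 2 ∣ p
  p-odd = prime>2⇒¬2∣ p-prime 2<p

  pCr≈0 : InnerChooseVanishes p
  pCr≈0 0<r r<p with p∣pCk p-prime 0<r r<p
  ... | divides q pCr≡q*p =
    trans (reflexive (≡.cong fromℕ pCr≡q*p)) (trans (fromℕ-* q p) (trans (*-congˡ char-p) (zeroʳ _)))

  sgn-pᵏ : ∀ k → sgn (p ^ k) ≈ - 1#
  sgn-pᵏ = sgn-^-odd (¬2∣⇒sgn≈-1 p-odd)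

  Δ₁^pᵏ≗Δpᵏ : ∀ k f → Δ^ 1 (p ^ k) f ≗ Δ (p ^ k) f
  Δ₁^pᵏ≗Δpᵏ k f z = trans (Δ^-frobenius-^ p-odd pCr≈0 k 1 f z)
                          (reflexive (≡.cong (λ s → Δ s f z) (ℕP.*-identityˡ (p ^ k))))

  A^[pᵏl]-even : ∀ k l m → 1 ≤ l → l ≡ 2 * m →
    A-rf ^^ (p ^ k * l)
      ≋ Σ≤ l (λ i → signedChoose l i ⊙ ⊕^ (+ (p ^ k) ℤ.* (+ l ℤ.- + (2 * i))) 𝕀)
        ⊞ Σ≤ (m ∸ 1) (λ i → signedChoose l i ⊙ J (p ^ k * (l ∸ 2 * i) ∸ 1))
  A^[pᵏl]-even k .0           zero    () ≡.refl
  A^[pᵏl]-even k .(2 * suc m) (suc m) _  ≡.refl a b =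
    trans (A^[n*l]-entry (sgn-pᵏ k) (Δ₁^pᵏ≗Δpᵏ k) h≤1+l below above a b)
          (+-congˡ (trans (trans (*-congʳ (sgn-2* (suc m))) (*-identityˡ _)) (sym (Σ≤-entry m _ a b))))
    where
    h≤1+l : suc m ≤ suc (2 * suc m)
    h≤1+l = ℕP.m≤n⇒m≤1+n (ℕP.m≤n*m (suc m) 2)
    below : ∀ r → r < suc m → 2 * r ≤ 2 * suc m
    below r r<h = ℕP.*-monoʳ-≤ 2 (ℕP.<⇒≤ r<h)
    above : ∀ r → suc m ≤ r → 2 * suc m ≤ 2 * r
    above r h≤r = ℕP.*-monoʳ-≤ 2 h≤r

  A^[pᵏl]-odd : ∀ k l m → l ≡ 2 * m + 1 →
    A-rf ^^ (p ^ k * l)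
      ≋ Σ≤ l (λ i → signedChoose l i ⊙ ⊕^ (+ (p ^ k) ℤ.* (+ l ℤ.- + (2 * i))) 𝕀)
        ⊟ Σ≤ m (λ i → signedChoose l i ⊙ J (p ^ k * (l ∸ 2 * i) ∸ 1))
  A^[pᵏl]-odd k .(2 * m + 1) m ≡.refl a b =
    trans (A^[n*l]-entry (sgn-pᵏ k) (Δ₁^pᵏ≗Δpᵏ k) h≤1+l below above a b)
          (+-congˡ (trans (trans (*-congʳ sgn-l) (-1*x≈-x _)) (-‿cong (sym (Σ≤-entry m _ a b)))))
    where
    sgn-l : sgn (2 * m + 1) ≈ - 1#
    sgn-l = trans (sgn-+ (2 * m) 1) (trans (*-congʳ (sgn-2* m)) (*-identityˡ _))
    h≤1+l : suc m ≤ suc (2 * m + 1)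
    h≤1+l = ℕ.s≤s (ℕP.≤-trans (ℕP.m≤n*m m 2) (ℕP.m≤m+n (2 * m) 1))
    below : ∀ r → r < suc m → 2 * r ≤ 2 * m + 1
    below r r<h = ℕP.≤-trans (ℕP.*-monoʳ-≤ 2 (ℕP.≤-pred r<h)) (ℕP.m≤m+n (2 * m) 1)
    above : ∀ r → suc m ≤ r → 2 * m + 1 ≤ 2 * r
    above r h≤r = begin
      2 * m + 1    ≡⟨ ℕP.+-comm (2 * m) 1 ⟩
      suc (2 * m)  <⟨ ℕP.n<1+n _ ⟩
      2 + 2 * m    ≡⟨ ℕP.*-suc 2 m ⟨
      2 * suc m    ≤⟨ ℕP.*-monoʳ-≤ 2 h≤r ⟩
      2 * r        ∎
      where open ℕP.≤-Reasoning

  A^pᵏ : ∀ k → A-rf ^^ (p ^ k) ≋ (⊕^ (+ (p ^ k)) 𝕀 ⊟ ⊖^ (p ^ k) 𝕀) ⊟ J (p ^ k ∸ 1)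
  A^pᵏ k a b =
    trans (reflexive (≡.cong (λ N → (A-rf ^^ N) a b) (≡.sym (ℕP.*-identityʳ n))))
          (trans (A^[pᵏl]-odd k 1 0 ≡.refl a b) (+-cong (+-cong F₀ F₁) (-‿cong G₀)))
    where
    n = p ^ k
    x-y-n[1-2]≡n+x-y : ∀ x y n → (x ℤ.- y) ℤ.- n ℤ.* (+ 1 ℤ.- + 2) ≡ (n ℤ.+ x) ℤ.- y
    x-y-n[1-2]≡n+x-y = solve-∀
    F₀ : signedChoose 1 0 *ᴿ ⊕^ (+ n ℤ.* (+ 1 ℤ.- + 0)) 𝕀 a b ≈ ⊕^ (+ n) 𝕀 a b
    F₀ = trans (*-congʳ (signedChoose-0 1))
               (trans (*-identityˡ _) (reflexive (≡.cong (λ z → ⊕^ z 𝕀 a b) (ℤP.*-identityʳ (+ n)))))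
    F₁ : signedChoose 1 1 *ᴿ ⊕^ (+ n ℤ.* (+ 1 ℤ.- + 2)) 𝕀 a b ≈ - ⊖^ n 𝕀 a b
    F₁ = trans (*-cong (signedChoose-diag 1) (⊕^-𝕀 _ a b))
               (trans (-1*x≈-x _)
                      (-‿cong (trans (reflexive (≡.cong δ (x-y-n[1-2]≡n+x-y (+ a) (+ b) (+ n))))
                                     (trans (δ-diff (n + a) b) (sym (reflexive (⊖-iter n 𝕀 a b)))))))
    G₀ : signedChoose 1 0 *ᴿ J (n * 1 ∸ 1) a b ≈ J (n ∸ 1) a b
    G₀ = trans (*-congʳ (signedChoose-0 1))
               (trans (*-identityˡ _) (reflexive (≡.cong (λ L → J (L ∸ 1) a b) (ℕP.*-identityʳ n))))

corollary1 : ∀ {c ℓ : Level} (R : CommutativeRing c ℓ) →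
  let open CommutativeRing R using () renaming (_*_ to _*ᴿ_)
      open FieldDefs R hiding (fromℕ)
      open MatrixDefs R
  in IsField → IsFinite → (p : ℕ) → Prime p → 2 < p → HasCharacteristic p →
    (∀ (k : ℕ) →
      A-rf ^^ (p ^ k) ≋ (⊕^ (+ (p ^ k)) 𝕀 ⊟ ⊖^ (p ^ k) 𝕀) ⊟ J (p ^ k ∸ 1))
    × (∀ (k l m : ℕ) → 1 ≤ l → l < p → l ≡ 2 * m →
      A-rf ^^ (p ^ k * l)
        ≋ Σ≤ l (λ i → (fromℕ (l C i) *ᴿ sgn i) ⊙ ⊕^ (+ (p ^ k) ℤ.* (+ l ℤ.- + (2 * i))) 𝕀)
          ⊞ Σ≤ (m ∸ 1) (λ i → (fromℕ (l C i) *ᴿ sgn i) ⊙ J (p ^ k * (l ∸ 2 * i) ∸ 1)))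
    × (∀ (k l m : ℕ) → 1 ≤ l → l < p → l ≡ 2 * m + 1 →
      A-rf ^^ (p ^ k * l)
        ≋ Σ≤ l (λ i → (fromℕ (l C i) *ᴿ sgn i) ⊙ ⊕^ (+ (p ^ k) ℤ.* (+ l ℤ.- + (2 * i))) 𝕀)
          ⊟ Σ≤ m (λ i → (fromℕ (l C i) *ᴿ sgn i) ⊙ J (p ^ k * (l ∸ 2 * i) ∸ 1)))
corollary1 R _ _ p p-prime 2<p char-p =
  A^pᵏ , (λ k l m 1≤l _ → A^[pᵏl]-even k l m 1≤l) , (λ k l m _ _ → A^[pᵏl]-odd k l m)
  where open OddCharacteristic R p-prime 2<p char-p
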